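{- Let $N,m,k\in\mathbb{N}$ with $\gcd(Nk,m)=1$. Then for every $(a,b)\in\mathcal{H}_{k,m}$, \[ \mathcal{L}_{N,m,k}=\{ax+by \bmod m: (x,y)\in\mathcal{H}_{N,m}\}. \]
   Context: For $N,m\in\mathbb{N}$, $\mathcal{H}_{N,m}:=\{(x,y)\in(\mathbb{Z}/m\mathbb{Z})^2: xy\equiv N \bmod m\}$, and for $k\in\mathbb{N}$ with $\gcd(Nk,m)=1$, $\mathcal{L}_{N,m,k}:=\{kx+y\bmod m:(x,y)\in\mathcal{H}_{N,m}\}$. -}

module Defs where

open import Data.Nat using (ℕ; _*_; _+_; NonZero)
open import Data.Nat.DivMod using (_%_)
open import Data.Fin using (Fin; toℕ)
open import Data.Product using (Σ; _×_; _,_; ∃-syntax)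
open import Relation.Binary.PropositionalEquality using (_≡_)

-- Residues mod m are represented by Fin m (canonical representatives 0..m-1).
-- H N m : the set {(x,y) ∈ (ℤ/mℤ)² : x y ≡ N (mod m)}, as a predicate.
H : (N m : ℕ) .{{_ : NonZero m}} → Fin m × Fin m → Set
H N m (x , y) = (toℕ x * toℕ y) % m ≡ N % m

L : (N m k : ℕ) .{{_ : NonZero m}} → Fin m → Set
L N m k z = ∃[ p ] (H N m p × ((k * toℕ (Data.Product.proj₁ p) + toℕ (Data.Product.proj₂ p)) % m ≡ toℕ z))
  where import Data.Product

L' : (N m : ℕ) .{{_ : NonZero m}} → Fin m × Fin m → Fin m → Set
L' N m (a , b) z = ∃[ p ] (H N m p × ((toℕ a * toℕ (Data.Product.proj₁ p) + toℕ b * toℕ (Data.Product.proj₂ p)) % m ≡ toℕ z))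
  where import Data.Product

{-# OPTIONS --safe #-}
module Submission where

-- Since ab ≡ k is invertible mod m, so is b, with inverse c = a k⁻¹. The
-- rescaling (x , y) ↦ (b x , c y) preserves the product x y (as b c ≡ 1), hence
-- maps H_{N,m} to itself, and turns a x + b y into a b x + b c y ≡ k x + y.
-- Its inverse (x , y) ↦ (c x , b y) gives the reverse inclusion.

open import Defs
open import Data.Nat using (ℕ; _*_; _+_; NonZero; suc; pred)
open import Data.Nat.Properties using (*-identityˡ; *-identityʳ; *-assoc; *-comm; suc-pred)
open import Data.Nat.DivMod
open import Data.Nat.Divisibility using (∣-trans; n∣m*n)
open import Data.Nat.Coprimality using (Coprime; gcd≡1⇒coprime; coprime-Bézout)
open import Data.Nat.GCD using (gcd; module Bézout)
open import Data.Nat.Solver using (module +-*-Solver)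
open import Data.Fin using (Fin; toℕ)
open import Data.Fin.Properties using (toℕ-fromℕ<)
open import Data.Product using (Σ; _×_; _,_; proj₁; proj₂; ∃-syntax)
open import Function.Bundles using (_⇔_; mk⇔; Equivalence)
open import Function.Base using (_∘_)
open import Relation.Binary.Bundles using (Setoid)
open import Relation.Binary.PropositionalEquality
  using (_≡_; refl; sym; trans; cong; cong₂; module ≡-Reasoning)
import Relation.Binary.PropositionalEquality.Properties as ≡
import Relation.Binary.Construct.On as On
import Relation.Binary.Reasoning.Setoid as SetoidReasoning

open +-*-Solver using (solve; _:+_; _:*_; _:=_; con)

coprime-factorʳ : ∀ {m n o} → Coprime (m * n) o → Coprime n o
coprime-factorʳ {m} c (d∣n , d∣o) = c (∣-trans d∣n (n∣m*n m) , d∣o)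

module Congruence (m : ℕ) .{{_ : NonZero m}} where

  ≈-setoid : Setoid _ _
  ≈-setoid = On.setoid {B = ℕ} (≡.setoid ℕ) (_% m)

  open Setoid ≈-setoid public using (_≈_) renaming (refl to ≈-refl)

  +-cong : ∀ {a a′ b b′} → a ≈ a′ → b ≈ b′ → a + b ≈ a′ + b′
  +-cong {a} {a′} {b} {b′} a≈a′ b≈b′ = begin
    (a + b) % m                 ≡⟨ %-distribˡ-+ a b m ⟩
    (a % m + b % m) % m         ≡⟨ cong₂ (λ u v → (u + v) % m) a≈a′ b≈b′ ⟩
    (a′ % m + b′ % m) % m       ≡⟨ sym (%-distribˡ-+ a′ b′ m) ⟩
    (a′ + b′) % m               ∎
    where open ≡-Reasoning

  *-cong : ∀ {a a′ b b′} → a ≈ a′ → b ≈ b′ → a * b ≈ a′ * b′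
  *-cong {a} {a′} {b} {b′} a≈a′ b≈b′ = begin
    (a * b) % m                 ≡⟨ %-distribˡ-* a b m ⟩
    (a % m * (b % m)) % m       ≡⟨ cong₂ (λ u v → (u * v) % m) a≈a′ b≈b′ ⟩
    (a′ % m * (b′ % m)) % m     ≡⟨ sym (%-distribˡ-* a′ b′ m) ⟩
    (a′ * b′) % m               ∎
    where open ≡-Reasoning

  toℕ-mod : ∀ n → toℕ (n mod m) ≈ n
  toℕ-mod n = trans (cong (_% m) (toℕ-fromℕ< (m%n<n n m))) (m%n%n≡m%n n m)

  coprime⇒invertible : ∀ {k} → Coprime k m → ∃[ u ] u * k ≈ 1
  coprime⇒invertible {k} c with coprime-Bézout c
  ... | Bézout.+- x y 1+ym≡xk = x , (begin
    x * k        ≡⟨ sym 1+ym≡xk ⟩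
    1 + y * m    ≈⟨ [m+kn]%n≡m%n 1 y m ⟩
    1            ∎)
    where open SetoidReasoning ≈-setoid
  -- Here x k ≡ -1, so (m - 1) x inverts k.
  ... | Bézout.-+ x y 1+xk≡ym = pred m * x , (begin
    pred m * x * k                   ≈⟨ sym ([m+n]%n≡m%n (pred m * x * k) m) ⟩
    pred m * x * k + m               ≡⟨ cong (pred m * x * k +_) (sym (suc-pred m)) ⟩
    pred m * x * k + suc (pred m)    ≡⟨ solve 3 (λ p x k → p :* x :* k :+ (con 1 :+ p) := con 1 :+ p :* (con 1 :+ x :* k)) refl (pred m) x k ⟩
    1 + pred m * (1 + x * k)         ≡⟨ cong (λ t → 1 + pred m * t) 1+xk≡ym ⟩
    1 + pred m * (y * m)             ≡⟨ cong (1 +_) (sym (*-assoc (pred m) y m)) ⟩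
    1 + pred m * y * m               ≈⟨ [m+kn]%n≡m%n 1 (pred m * y) m ⟩
    1                                ∎)
    where open SetoidReasoning ≈-setoid

  module _ (a b : ℕ) {k u} (ab≈k : a * b ≈ k) (uk≈1 : u * k ≈ 1) where

    b*[a*u]≈1 : b * (a * u) ≈ 1
    b*[a*u]≈1 = begin
      b * (a * u)   ≡⟨ solve 3 (λ a b u → b :* (a :* u) := u :* (a :* b)) refl a b u ⟩
      u * (a * b)   ≈⟨ *-cong (≈-refl {u}) ab≈k ⟩
      u * k         ≈⟨ uk≈1 ⟩
      1             ∎
      where open SetoidReasoning ≈-setoid

    k*[a*u]≈a : k * (a * u) ≈ a
    k*[a*u]≈a = begin
      k * (a * u)   ≡⟨ solve 3 (λ k a u → k :* (a :* u) := a :* (u :* k)) refl k a u ⟩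
      a * (u * k)   ≈⟨ *-cong (≈-refl {a}) uk≈1 ⟩
      a * 1         ≡⟨ *-identityʳ a ⟩
      a             ∎
      where open SetoidReasoning ≈-setoid

  scale : ℕ → Fin m → Fin m
  scale s x = (s * toℕ x) mod m

  H-scale : ∀ {N} s t {x y} → s * t ≈ 1 → H N m (x , y) → H N m (scale s x , scale t y)
  H-scale {N} s t {x} {y} st≈1 xy≈N = begin
    toℕ (scale s x) * toℕ (scale t y)   ≈⟨ *-cong (toℕ-mod (s * toℕ x)) (toℕ-mod (t * toℕ y)) ⟩
    (s * toℕ x) * (t * toℕ y)           ≡⟨ solve 4 (λ s x t y → (s :* x) :* (t :* y) := (s :* t) :* (x :* y)) refl s (toℕ x) t (toℕ y) ⟩
    (s * t) * (toℕ x * toℕ y)           ≈⟨ *-cong st≈1 xy≈N ⟩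
    1 * N                               ≡⟨ *-identityˡ N ⟩
    N                                   ∎
    where open SetoidReasoning ≈-setoid

  scale-linear : ∀ {α β} α′ β′ s t → α′ * s ≈ α → β′ * t ≈ β → ∀ x y →
                 α′ * toℕ (scale s x) + β′ * toℕ (scale t y) ≈ α * toℕ x + β * toℕ y
  scale-linear {α} {β} α′ β′ s t α′s≈α β′t≈β x y = begin
    α′ * toℕ (scale s x) + β′ * toℕ (scale t y)
      ≈⟨ +-cong (*-cong (≈-refl {α′}) (toℕ-mod (s * toℕ x))) (*-cong (≈-refl {β′}) (toℕ-mod (t * toℕ y))) ⟩
    α′ * (s * toℕ x) + β′ * (t * toℕ y)
      ≡⟨ sym (cong₂ _+_ (*-assoc α′ s (toℕ x)) (*-assoc β′ t (toℕ y))) ⟩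
    α′ * s * toℕ x + β′ * t * toℕ y
      ≈⟨ +-cong (*-cong α′s≈α (≈-refl {toℕ x})) (*-cong β′t≈β (≈-refl {toℕ y})) ⟩
    α * toℕ x + β * toℕ y ∎
    where open SetoidReasoning ≈-setoid

  -- L' N m (a , b) is Image N (toℕ a) (toℕ b) on the nose.
  Image : ℕ → ℕ → ℕ → Fin m → Set
  Image N α β z = ∃[ p ] (H N m p × (α * toℕ (proj₁ p) + β * toℕ (proj₂ p)) % m ≡ toℕ z)

  Image-scale : ∀ {N α β} α′ β′ s t → s * t ≈ 1 → α′ * s ≈ α → β′ * t ≈ β →
                ∀ {z} → Image N α β z → Image N α′ β′ z
  Image-scale α′ β′ s t st≈1 α′s≈α β′t≈β ((x , y) , xy≈N , αx+βy≡z) =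
    (scale s x , scale t y) , H-scale s t st≈1 xy≈N , trans (scale-linear α′ β′ s t α′s≈α β′t≈β x y) αx+βy≡z

  L⇔Image : ∀ N k z → L N m k z ⇔ Image N k 1 z
  L⇔Image N k z = mk⇔ (λ (p , h , e) → p , h , trans (y≡1*y p) e) (λ (p , h , e) → p , h , trans (sym (y≡1*y p)) e)
    where
    y≡1*y : ∀ p → (k * toℕ (proj₁ p) + 1 * toℕ (proj₂ p)) % m ≡ (k * toℕ (proj₁ p) + toℕ (proj₂ p)) % m
    y≡1*y p = cong (λ t → (k * toℕ (proj₁ p) + t) % m) (*-identityˡ (toℕ (proj₂ p)))

lemma3p2 : (N m k : ℕ) .{{_ : NonZero m}} → gcd (N * k) m ≡ 1 →
           (ab : Fin m × Fin m) → H k m ab →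
           (z : Fin m) → L N m k z ⇔ L' N m ab z
lemma3p2 N m k gcd≡1 (a , b) ab≈k z = mk⇔
  (Image-scale (toℕ a) (toℕ b) (toℕ b) c bc≈1 ab≈k bc≈1 ∘ to)
  (from ∘ Image-scale k 1 c (toℕ b) cb≈1 kc≈a 1*b≈b)
  where
  open Congruence m
  open Equivalence (L⇔Image N k z) using (to; from)
  open Σ (coprime⇒invertible (coprime-factorʳ {N} (gcd≡1⇒coprime gcd≡1))) renaming (proj₁ to u; proj₂ to uk≈1)

  c : ℕ
  c = toℕ a * u

  bc≈1 : toℕ b * c ≈ 1
  bc≈1 = b*[a*u]≈1 (toℕ a) (toℕ b) ab≈k uk≈1

  cb≈1 : c * toℕ b ≈ 1
  cb≈1 = trans (cong (_% m) (*-comm c (toℕ b))) bc≈1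

  kc≈a : k * c ≈ toℕ a
  kc≈a = k*[a*u]≈a (toℕ a) (toℕ b) ab≈k uk≈1

  1*b≈b : 1 * toℕ b ≈ toℕ b
  1*b≈b = cong (_% m) (*-identityˡ (toℕ b))
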